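{- We have $|\mathcal{P}_n(132,321)| = 2n-2$ for all $n\ge 2$; $|\mathcal{P}_n(132,4321)| = 2n^2-8n+11$ for all $n\ge 3$; $|\mathcal{P}_n(132,54321)| = \frac{4}{3}n^3 - 12n^2 + \frac{128}{3}n - 52$ for all $n\ge 4$.
   Context: $S_n$ is the set of permutations of $\{1,\dots,n\}$ in one-line notation. A permutation avoids a pattern $\sigma\in S_k$ if it has no subsequence of length $k$ whose entries are in the same relative order as $\sigma$. $\mathcal{P}_n(132,\tau)$ is the set of permutations in $S_n$ avoiding each of $132$, $2341$, $3241$ and $\tau$ (equivalently, the two-stack sortable permutations avoiding $132$ and $\tau$). -}

module Defs where

open import Data.Nat using (ℕ; suc; _<_)
open import Data.List using (List; length; lookup; map; upTo; [_]; _∷_; [])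
open import Data.List.Relation.Binary.Sublist.Propositional using (_⊆_)
open import Data.List.Relation.Binary.Permutation.Propositional using (_↭_)
open import Data.List.Relation.Unary.Unique.Propositional using (Unique)
open import Data.List.Membership.Propositional using (_∈_)
open import Data.Fin using (Fin; cast)
open import Data.Product using (Σ; _×_)
open import Function.Bundles using (_⇔_)
open import Relation.Nullary using (¬_)
open import Relation.Binary.PropositionalEquality using (_≡_)

IsPerm : ℕ → List ℕ → Set
IsPerm n w = w ↭ map suc (upTo n)

OrderIso : List ℕ → List ℕ → Set
OrderIso u σ = Σ (length u ≡ length σ) λ eq →
  (i j : Fin (length u)) →
    (lookup u i < lookup u j) ⇔ (lookup σ (cast eq i) < lookup σ (cast eq j))

Contains : List ℕ → List ℕ → Set
Contains w σ = Σ (List ℕ) λ u → (u ⊆ w) × OrderIso u σ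

Avoids : List ℕ → List ℕ → Set
Avoids w σ = ¬ Contains w σ

-- P_n(132, τ): permutations of [n] avoiding 132, 2341, 3241 and τ.
InP : ℕ → List ℕ → List ℕ → Set
InP n τ w = IsPerm n w × Avoids w (1 ∷ 3 ∷ 2 ∷ []) × Avoids w (2 ∷ 3 ∷ 4 ∷ 1 ∷ [])
          × Avoids w (3 ∷ 2 ∷ 4 ∷ 1 ∷ []) × Avoids w τ

HasCard : (List ℕ → Set) → ℕ → Set
HasCard P k = Σ (List (List ℕ)) λ L →
  Unique L × ((w : List ℕ) → (w ∈ L) ⇔ P w) × (length L ≡ k)

-- Let N = n + 2 be the largest entry of a permutation w avoiding 132, 2341, 3241 and k⋯21.
-- If N has two entries a, a′ before it and one entry b after it, then a N b or a′ N b is a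
-- 132, or a a′ N b is a 2341 or a 3241. If N has exactly one entry a before it and some
-- entries after it, avoiding 132 forces them all below a, so a = N − 1. Hence w is α N,
-- or N β, or (N − 1) N β, and deleting N (resp. N − 1 and N) is a bijection onto the
-- smaller classes, the decreasing pattern losing one letter in the last two cases:
--   c(n + 2, k + 1) = c(n + 1, k + 1) + c(n + 1, k) + c(n, k)   (last term absent for n = 0).
module Submission where

import Relation.Binary.PropositionalEquality as Eq

open import Defs
open import Data.Nat using (ℕ; zero; suc; _≤_; _<_; _>_; _∸_; _*_; _+_; z≤n; s≤s; s≤s⁻¹)
open import Data.Nat.Properties
  using (suc-injective; n<1+n; <-irrefl; <-asym; <-trans; <-≤-trans; <-cmp; ≤-refl; m≤n⇒m<n∨m≡n
        ; *-distribˡ-+)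
open import Data.Nat.Tactic.RingSolver using (solve; solve-∀)
open import Data.Fin using (zero; suc; toℕ; cast)
open import Data.Fin.Properties using (toℕ-cast; cast-trans)
open import Data.List using (List; _∷_; []; [_]; _++_; upTo; map; length; lookup; applyDownFrom)
open import Data.List.Properties
  using (∷-injectiveˡ; ∷-injectiveʳ; ∷ʳ-injectiveˡ; length-++; length-map; length-applyDownFrom
        ; upTo-∷ʳ; map-++; ++-identityʳ)
open import Data.List.Membership.Propositional using (_∈_)
open import Data.List.Membership.Propositional.Properties
  using (∈-lookup; ∈-++⁺ˡ; ∈-++⁺ʳ; ∈-++⁻; ∈-∃++; ∈-map⁺; ∈-map⁻)
open import Data.List.Relation.Unary.All as All using (All; []; _∷_)
import Data.List.Relation.Unary.All.Properties as All
open import Data.List.Relation.Unary.AllPairs using (AllPairs; []; _∷_)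
open import Data.List.Relation.Unary.AllPairs.Properties using (applyDownFrom⁺₁)
open import Data.List.Relation.Unary.Any using (here; there; index)
open import Data.List.Relation.Unary.Any.Properties using (lookup-index)
open import Data.List.Relation.Unary.Linked using (Linked; [-]; _∷_)
open import Data.List.Relation.Unary.Unique.Propositional using (Unique)
import Data.List.Relation.Unary.Unique.Propositional.Properties as Unique
open import Data.List.Relation.Binary.Sublist.Propositional
  using (_⊆_; []; _∷_; _∷ʳ_; ⊆-refl; ⊆-trans; minimum; from∈)
open import Data.List.Relation.Binary.Sublist.Propositional.Properties using (All-resp-⊆; ∷ˡ⁻; ++⁺ˡ; ++⁺ʳ)
open import Data.List.Relation.Binary.Permutation.Propositional
  using (_↭_; ↭-refl; ↭-sym; ↭-trans; swap; ↭⇒↭ₛ)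
import Data.List.Relation.Binary.Permutation.Propositional.Properties as ↭
open import Data.List.Relation.Binary.Permutation.Propositional.Properties
  using (↭-length; ↭-empty-inv; ↭-singleton-inv; All-resp-↭; ∈-resp-↭; ∷↭∷ʳ; drop-mid; ¬x∷xs↭[])
open import Data.List.Relation.Binary.Permutation.Setoid.Properties (Eq.setoid ℕ) using (Unique-resp-↭)
open import Data.Product using (_×_; Σ; ∃; _,_)
open import Data.Sum as Sum using (_⊎_; inj₁; inj₂; [_,_]′)
open import Data.Empty using (⊥; ⊥-elim)
open import Function.Base using (_∘_)
open import Function.Bundles using (_⇔_; mk⇔; Equivalence)
import Function.Properties.Equivalence as ⇔
open import Relation.Nullary using (¬_)
open import Relation.Unary using (∅; _∪_)
open import Relation.Binary.Definitions using (tri<; tri≈; tri>)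
open import Relation.Binary.PropositionalEquality
  using (_≡_; _≢_; refl; sym; trans; cong; cong₂; subst; subst₂; module ≡-Reasoning)

-- Order isomorphisms

lookup-map : ∀ {A B : Set} (f : A → B) xs i → lookup (map f xs) i ≡ f (lookup xs (cast (length-map f xs) i))
lookup-map f (x ∷ xs) zero    = refl
lookup-map f (x ∷ xs) (suc i) = lookup-map f xs i

lookup-All : ∀ {P : ℕ → Set} {xs} → All P xs → ∀ i → P (lookup xs i)
lookup-All ps i = All.lookup ps (∈-lookup i)

All-fromLookup : ∀ {P : ℕ → Set} {xs} → (∀ i → P (lookup xs i)) → All P xs
All-fromLookup {P} p = All.tabulate λ x∈ → subst P (sym (lookup-index x∈)) (p (index x∈))

Increasing : (ℕ → ℕ) → Set
Increasing f = ∀ n → f n < f (suc n)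

increasing⇒< : ∀ {f} → Increasing f → ∀ {m n} → m < n → f m < f n
increasing⇒< inc {m} {suc n} (s≤s m≤n) with m≤n⇒m<n∨m≡n m≤n
... | inj₁ m<n  = <-trans (increasing⇒< inc m<n) (inc n)
... | inj₂ refl = inc n

increasing⇒⇔ : ∀ {f} → Increasing f → ∀ {m n} → m < n ⇔ f m < f n
increasing⇒⇔ {f} inc {m} {n} = mk⇔ (increasing⇒< inc) reflect
  where
  reflect : f m < f n → m < n
  reflect fm<fn with <-cmp m n
  ... | tri< m<n _ _  = m<n
  ... | tri≈ _ refl _ = ⊥-elim (<-irrefl refl fm<fn)
  ... | tri> _ _ n<m  = ⊥-elim (<-asym fm<fn (increasing⇒< inc n<m))

-- An occurrence of a pattern is the image of the pattern under an increasing map, namely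
-- chainMap through its entries listed in increasing order; this is how the inequalities
-- describing an occurrence are turned into an order isomorphism.
orderIso-map : ∀ {f g} → Increasing f → Increasing g → ∀ π → OrderIso (map f π) (map g π)
orderIso-map {f} {g} incf incg π = eq , iso
  where
  eq = trans (length-map f π) (sym (length-map g π))
  iso : ∀ i j → (lookup (map f π) i < lookup (map f π) j)
              ⇔ (lookup (map g π) (cast eq i) < lookup (map g π) (cast eq j))
  iso i j
    rewrite lookup-map f π i | lookup-map f π j
          | lookup-map g π (cast eq i) | lookup-map g π (cast eq j)
          | cast-trans eq (length-map g π) i | cast-trans eq (length-map g π) j
          = ⇔.trans (⇔.sym (increasing⇒⇔ incf)) (increasing⇒⇔ incg)

chainMap : ℕ → List ℕ → ℕ → ℕ
chainMap x xs       zero    = x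
chainMap x []       (suc n) = suc n + x
chainMap x (y ∷ ys) (suc n) = chainMap y ys n

chainMap-increasing : ∀ {x xs} → Linked _<_ (x ∷ xs) → Increasing (chainMap x xs)
chainMap-increasing {xs = []}     _         zero    = ≤-refl
chainMap-increasing {xs = []}     _         (suc n) = ≤-refl
chainMap-increasing {xs = _ ∷ _}  (x<y ∷ _) zero    = x<y
chainMap-increasing {xs = _ ∷ _}  (_ ∷ l)   (suc n) = chainMap-increasing l n

suc-increasing : Increasing suc
suc-increasing _ = ≤-refl

lookup-decreasing : ∀ {u} → AllPairs _>_ u → ∀ i j → lookup u i < lookup u j ⇔ toℕ j < toℕ i
lookup-decreasing (_ ∷ _)   zero    zero    = mk⇔ (λ x<x → ⊥-elim (<-irrefl refl x<x)) λ ()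
lookup-decreasing (u<x ∷ _) zero    (suc j) = mk⇔ (λ x<u → ⊥-elim (<-asym x<u (lookup-All u<x j))) λ ()
lookup-decreasing (u<x ∷ _) (suc i) zero    = mk⇔ (λ _ → s≤s z≤n) (λ _ → lookup-All u<x i)
lookup-decreasing (_ ∷ d)   (suc i) (suc j) = ⇔.trans (lookup-decreasing d i j) (mk⇔ s≤s s≤s⁻¹)

decreasing-orderIso : ∀ {u v} → length u ≡ length v → AllPairs _>_ u → AllPairs _>_ v → OrderIso u v
decreasing-orderIso {v = v} eq du dv = eq , λ i j →
  ⇔.trans (lookup-decreasing du i j)
          (⇔.sym (subst₂ (λ a b → (lookup v (cast eq i) < lookup v (cast eq j)) ⇔ (b < a))
                         (toℕ-cast eq i) (toℕ-cast eq j) (lookup-decreasing dv (cast eq i) (cast eq j))))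

orderIso-resp-decreasing : ∀ {u v} → OrderIso u v → AllPairs _>_ v → AllPairs _>_ u
orderIso-resp-decreasing {[]}    _          []         = []
orderIso-resp-decreasing {_ ∷ _} {_ ∷ _} (eq , iso) (v<y ∷ dv) =
  All-fromLookup (λ i → Equivalence.from (iso (suc i) zero) (lookup-All v<y (cast _ i)))
  ∷ orderIso-resp-decreasing (suc-injective eq , λ i j → iso (suc i) (suc j)) dv

⊆-++[]⁻ : ∀ {x : ℕ} {v} u → v ⊆ u ++ [ x ] → v ⊆ u ⊎ ∃ λ v′ → v ≡ v′ ++ [ x ] × v′ ⊆ u
⊆-++[]⁻ []      (_ ∷ʳ v⊆[]) = inj₁ v⊆[]
⊆-++[]⁻ []      (refl ∷ []) = inj₂ ([] , refl , [])
⊆-++[]⁻ (a ∷ u) (_ ∷ʳ v⊆)   =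
  Sum.map (a ∷ʳ_) (λ (v′ , eq , v′⊆u) → v′ , eq , a ∷ʳ v′⊆u) (⊆-++[]⁻ u v⊆)
⊆-++[]⁻ (a ∷ u) (refl ∷ v⊆) with ⊆-++[]⁻ u v⊆
... | inj₁ v⊆u                = inj₁ (refl ∷ v⊆u)
... | inj₂ (v′ , refl , v′⊆u) = inj₂ (a ∷ v′ , refl , refl ∷ v′⊆u)

AllPairs-resp-⊆ : ∀ {R : ℕ → ℕ → Set} {u w} → u ⊆ w → AllPairs R w → AllPairs R u
AllPairs-resp-⊆ []           []        = []
AllPairs-resp-⊆ (_ ∷ʳ u⊆w)   (_ ∷ pw)  = AllPairs-resp-⊆ u⊆w pw
AllPairs-resp-⊆ (refl ∷ u⊆w) (px ∷ pw) = All-resp-⊆ u⊆w px ∷ AllPairs-resp-⊆ u⊆w pw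

last-in-suffix : ∀ {x : ℕ} α γ {b β} → α ++ [ x ] ≡ γ ++ b ∷ β → x ∈ b ∷ β
last-in-suffix α       []          eq = subst (_ ∈_) eq (∈-++⁺ʳ α (here refl))
last-in-suffix (_ ∷ α) (_ ∷ γ)     eq = last-in-suffix α γ (∷-injectiveʳ eq)
last-in-suffix []      (_ ∷ [])    ()
last-in-suffix []      (_ ∷ _ ∷ _) ()

Image : (List ℕ → List ℕ) → (List ℕ → Set) → List ℕ → Set
Image f P w = ∃ λ u → P u × f u ≡ w

hasCard-resp : ∀ {P Q : List ℕ → Set} {c} → (∀ w → P w ⇔ Q w) → HasCard P c → HasCard Q c
hasCard-resp P⇔Q (L , unique , mem , len) = L , unique , (λ w → ⇔.trans (mem w) (P⇔Q w)) , len

hasCard-∅ : ∀ {P : List ℕ → Set} → (∀ w → ¬ P w) → HasCard P 0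
hasCard-∅ ¬P = [] , [] , (λ w → mk⇔ (λ ()) (⊥-elim ∘ ¬P w)) , refl

hasCard-singleton : ∀ {P : List ℕ → Set} v → (∀ w → w ≡ v ⇔ P w) → HasCard P 1
hasCard-singleton v ≡v⇔P =
  [ v ] , [] ∷ []
  , (λ w → ⇔.trans (mk⇔ (λ { (here w≡v) → w≡v ; (there ()) }) here) (≡v⇔P w))
  , refl

hasCard-∪ : ∀ {P Q : List ℕ → Set} {a b} → (∀ {w} → P w → ¬ Q w) →
            HasCard P a → HasCard Q b → HasCard (P ∪ Q) (a + b)
hasCard-∪ disjoint (L , uniqueL , memL , lenL) (M , uniqueM , memM , lenM) =
  L ++ M
  , Unique.++⁺ uniqueL uniqueM (λ (w∈L , w∈M) → disjoint (to (memL _) w∈L) (to (memM _) w∈M))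
  , (λ w → mk⇔ (Sum.map (to (memL w)) (to (memM w)) ∘ ∈-++⁻ L)
               [ ∈-++⁺ˡ ∘ from (memL w) , ∈-++⁺ʳ L ∘ from (memM w) ]′)
  , trans (length-++ L) (cong₂ _+_ lenL lenM)
  where open Equivalence

hasCard-image : ∀ {P : List ℕ → Set} {f c} → (∀ {u v} → f u ≡ f v → u ≡ v) →
                HasCard P c → HasCard (Image f P) c
hasCard-image {f = f} f-injective (L , unique , mem , len) =
  map f L
  , Unique.map⁺ f-injective unique
  , (λ w → mk⇔ (λ w∈ → let u , u∈L , w≡fu = ∈-map⁻ f w∈ in u , to (mem u) u∈L , sym w≡fu)
               (λ { (u , Pu , refl) → ∈-map⁺ f (from (mem u) Pu) }))
  , trans (length-map f L) len
  where open Equivalence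

Occurs : (List ℕ → Set) → List ℕ → Set
Occurs P w = ∃ λ u → u ⊆ w × P u

occurs-⊆ : ∀ {P u w} → u ⊆ w → Occurs P u → Occurs P w
occurs-⊆ u⊆w (v , v⊆u , p) = v , ⊆-trans v⊆u u⊆w , p

contains⇔occurs : ∀ {σ P} → (∀ {u} → OrderIso u σ ⇔ P u) → ∀ {w} → Contains w σ ⇔ Occurs P w
contains⇔occurs iso = mk⇔ (λ (u , u⊆w , o) → u , u⊆w , Equivalence.to iso o)
                          (λ (u , u⊆w , p) → u , u⊆w , Equivalence.from iso p)

Occ132 : List ℕ → Set
Occ132 (a ∷ b ∷ c ∷ []) = a < c × c < b
Occ132 _                = ⊥

Occ2341 : List ℕ → Set
Occ2341 (a ∷ b ∷ c ∷ d ∷ []) = d < a × a < b × b < c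
Occ2341 _                    = ⊥

Occ3241 : List ℕ → Set
Occ3241 (a ∷ b ∷ c ∷ d ∷ []) = d < b × b < a × a < c
Occ3241 _                    = ⊥

Decreasing : ℕ → List ℕ → Set
Decreasing k u = length u ≡ k × AllPairs _>_ u

orderIso-132 : ∀ {u} → OrderIso u (1 ∷ 3 ∷ 2 ∷ []) ⇔ Occ132 u
orderIso-132 = mk⇔ to from
  where
  to : ∀ {u} → OrderIso u (1 ∷ 3 ∷ 2 ∷ []) → Occ132 u
  to {_ ∷ _ ∷ _ ∷ []} (_ , iso) = Equivalence.from (iso zero (suc (suc zero))) ≤-refl
                                , Equivalence.from (iso (suc (suc zero)) (suc zero)) ≤-refl
  from : ∀ {u} → Occ132 u → OrderIso u (1 ∷ 3 ∷ 2 ∷ [])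
  from {_ ∷ _ ∷ _ ∷ []} (a<c , c<b) =
    orderIso-map (chainMap-increasing (a<c ∷ c<b ∷ [-])) suc-increasing (0 ∷ 2 ∷ 1 ∷ [])

orderIso-2341 : ∀ {u} → OrderIso u (2 ∷ 3 ∷ 4 ∷ 1 ∷ []) ⇔ Occ2341 u
orderIso-2341 = mk⇔ to from
  where
  to : ∀ {u} → OrderIso u (2 ∷ 3 ∷ 4 ∷ 1 ∷ []) → Occ2341 u
  to {_ ∷ _ ∷ _ ∷ _ ∷ []} (_ , iso) = Equivalence.from (iso (suc (suc (suc zero))) zero) ≤-refl
                                    , Equivalence.from (iso zero (suc zero)) ≤-refl
                                    , Equivalence.from (iso (suc zero) (suc (suc zero))) ≤-refl
  from : ∀ {u} → Occ2341 u → OrderIso u (2 ∷ 3 ∷ 4 ∷ 1 ∷ [])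
  from {_ ∷ _ ∷ _ ∷ _ ∷ []} (d<a , a<b , b<c) =
    orderIso-map (chainMap-increasing (d<a ∷ a<b ∷ b<c ∷ [-])) suc-increasing (1 ∷ 2 ∷ 3 ∷ 0 ∷ [])

orderIso-3241 : ∀ {u} → OrderIso u (3 ∷ 2 ∷ 4 ∷ 1 ∷ []) ⇔ Occ3241 u
orderIso-3241 = mk⇔ to from
  where
  to : ∀ {u} → OrderIso u (3 ∷ 2 ∷ 4 ∷ 1 ∷ []) → Occ3241 u
  to {_ ∷ _ ∷ _ ∷ _ ∷ []} (_ , iso) = Equivalence.from (iso (suc (suc (suc zero))) (suc zero)) ≤-refl
                                    , Equivalence.from (iso (suc zero) zero) ≤-refl
                                    , Equivalence.from (iso zero (suc (suc zero))) ≤-refl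
  from : ∀ {u} → Occ3241 u → OrderIso u (3 ∷ 2 ∷ 4 ∷ 1 ∷ [])
  from {_ ∷ _ ∷ _ ∷ _ ∷ []} (d<b , b<a , a<c) =
    orderIso-map (chainMap-increasing (d<b ∷ b<a ∷ a<c ∷ [-])) suc-increasing (2 ∷ 1 ∷ 3 ∷ 0 ∷ [])

orderIso-decreasing : ∀ {k u} → OrderIso u (applyDownFrom suc k) ⇔ Decreasing k u
orderIso-decreasing {k} = mk⇔
  (λ o@(eq , _) → trans eq (length-applyDownFrom suc k) , orderIso-resp-decreasing o pattern-decreasing)
  (λ (eq , du) → decreasing-orderIso (trans eq (sym (length-applyDownFrom suc k))) du pattern-decreasing)
  where
  pattern-decreasing : AllPairs _>_ (applyDownFrom suc k)
  pattern-decreasing = applyDownFrom⁺₁ suc k (λ j<i _ → s≤s j<i)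

-- Occurrences through a new maximum

record MaxInsertionSafe (P : List ℕ → Set) : Set where
  field
    ¬max-first      : ∀ {x u} → All (_< x) u → ¬ P (x ∷ u)
    ¬max-last       : ∀ {x u} → All (_< x) u → ¬ P (u ++ [ x ])
    ¬top-pair-first : ∀ {x u} → All (_< x) u → ¬ P (x ∷ suc x ∷ u)
open MaxInsertionSafe

module _ {P : List ℕ → Set} (safe : MaxInsertionSafe P) where

  occurs-max-last : ∀ {x u} → All (_< x) u → Occurs P (u ++ [ x ]) → Occurs P u
  occurs-max-last {u = u} u<x (v , v⊆ , p) with ⊆-++[]⁻ u v⊆
  ... | inj₁ v⊆u                = v , v⊆u , p
  ... | inj₂ (v′ , refl , v′⊆u) = ⊥-elim (¬max-last safe (All-resp-⊆ v′⊆u u<x) p)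

  occurs-max-first : ∀ {x u} → All (_< x) u → Occurs P (x ∷ u) → Occurs P u
  occurs-max-first u<x (v , (_ ∷ʳ v⊆u) , p)        = v , v⊆u , p
  occurs-max-first u<x (_ ∷ v , (refl ∷ v⊆u) , p) = ⊥-elim (¬max-first safe (All-resp-⊆ v⊆u u<x) p)

  occurs-top-pair-first : ∀ {x u} → All (_< x) u → Occurs P (x ∷ suc x ∷ u) → Occurs P u
  occurs-top-pair-first u<x (v , (_ ∷ʳ v⊆) , p) =
    occurs-max-first (All.map (λ y<x → <-trans y<x (n<1+n _)) u<x) (v , v⊆ , p)
  occurs-top-pair-first u<x (_ ∷ v , (refl ∷ (_ ∷ʳ v⊆u)) , p) =
    ⊥-elim (¬max-first safe (All-resp-⊆ v⊆u u<x) p)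
  occurs-top-pair-first u<x (_ ∷ _ ∷ v , (refl ∷ (refl ∷ v⊆u)) , p) =
    ⊥-elim (¬top-pair-first safe (All-resp-⊆ v⊆u u<x) p)

safe-132 : MaxInsertionSafe Occ132
¬max-first      safe-132 {u = _ ∷ _ ∷ []} (_ ∷ c<x ∷ []) (x<c , _) = <-asym x<c c<x
¬max-last       safe-132 {u = _ ∷ _ ∷ []} (_ ∷ b<x ∷ []) (_ , x<b) = <-asym x<b b<x
¬max-last       safe-132 {u = _ ∷ _ ∷ _ ∷ []}    _ ()
¬max-last       safe-132 {u = _ ∷ _ ∷ _ ∷ _ ∷ _} _ ()
¬top-pair-first safe-132 {u = _ ∷ []} (c<x ∷ []) (x<c , _) = <-asym x<c c<x

safe-2341 : MaxInsertionSafe Occ2341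
¬max-first      safe-2341 {u = _ ∷ _ ∷ _ ∷ []} (b<x ∷ _) (_ , x<b , _) = <-asym x<b b<x
¬max-last       safe-2341 {u = _ ∷ _ ∷ _ ∷ []} (a<x ∷ _) (x<a , _)     = <-asym x<a a<x
¬max-last       safe-2341 {u = _ ∷ _ ∷ _ ∷ _ ∷ []}    _ ()
¬max-last       safe-2341 {u = _ ∷ _ ∷ _ ∷ _ ∷ _ ∷ _} _ ()
¬top-pair-first safe-2341 {u = _ ∷ _ ∷ []} (c<x ∷ _) (_ , _ , 1+x<c) = <-asym (<-trans (n<1+n _) 1+x<c) c<x

safe-3241 : MaxInsertionSafe Occ3241
¬max-first      safe-3241 {u = _ ∷ _ ∷ _ ∷ []} (_ ∷ c<x ∷ _) (_ , _ , x<c) = <-asym x<c c<x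
¬max-last       safe-3241 {u = _ ∷ _ ∷ _ ∷ []} (_ ∷ b<x ∷ _) (x<b , _)     = <-asym x<b b<x
¬max-last       safe-3241 {u = _ ∷ _ ∷ _ ∷ _ ∷ []}    _ ()
¬max-last       safe-3241 {u = _ ∷ _ ∷ _ ∷ _ ∷ _ ∷ _} _ ()
¬top-pair-first safe-3241 {u = _ ∷ _ ∷ []} _ (_ , 1+x<x , _) = <-asym 1+x<x (n<1+n _)

decreasing-tail : ∀ {k y v} → Decreasing (suc k) (y ∷ v) → Decreasing k v
decreasing-tail (len , _ ∷ dv) = suc-injective len , dv

occurs-decreasing-max-first : ∀ {k x u} → All (_< x) u →
                              Occurs (Decreasing (suc k)) (x ∷ u) ⇔ Occurs (Decreasing k) u
occurs-decreasing-max-first {x = x} u<x = mk⇔ to from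
  where
  to : Occurs (Decreasing (suc _)) (x ∷ _) → Occurs (Decreasing _) _
  to (_ ∷ v , (_ ∷ʳ v⊆u) , d)   = v , ∷ˡ⁻ v⊆u , decreasing-tail d
  to (_ ∷ v , (refl ∷ v⊆u) , d) = v , v⊆u , decreasing-tail d
  from : Occurs (Decreasing _) _ → Occurs (Decreasing (suc _)) (x ∷ _)
  from (v , v⊆u , len , dv) = x ∷ v , refl ∷ v⊆u , cong suc len , All-resp-⊆ v⊆u u<x ∷ dv

occurs-decreasing-top-pair-first : ∀ {k x u} → All (_< x) u →
                                   Occurs (Decreasing (suc k)) (x ∷ suc x ∷ u) ⇔ Occurs (Decreasing k) u
occurs-decreasing-top-pair-first {x = x} u<x = mk⇔ to from
  where
  to : Occurs (Decreasing (suc _)) (x ∷ suc x ∷ _) → Occurs (Decreasing _) _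
  to (v , (_ ∷ʳ v⊆) , d) =
    Equivalence.to (occurs-decreasing-max-first (All.map (λ y<x → <-trans y<x (n<1+n _)) u<x)) (v , v⊆ , d)
  to (_ ∷ v , (refl ∷ (_ ∷ʳ v⊆u)) , d) = v , v⊆u , decreasing-tail d
  to (_ ∷ _ ∷ _ , (refl ∷ (refl ∷ _)) , (_ , (1+x<x ∷ _) ∷ _)) = ⊥-elim (<-asym 1+x<x (n<1+n x))
  from : Occurs (Decreasing _) _ → Occurs (Decreasing (suc _)) (x ∷ suc x ∷ _)
  from (v , v⊆u , len , dv) = x ∷ v , refl ∷ (suc x ∷ʳ v⊆u) , cong suc len , All-resp-⊆ v⊆u u<x ∷ dv

occurs-decreasing-max-last : ∀ {k x a u} → All (_< x) (a ∷ u) →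
                             Occurs (Decreasing (suc k)) (a ∷ u ++ [ x ]) → Occurs (Decreasing (suc k)) (a ∷ u)
occurs-decreasing-max-last {a = a} {u} u<x (v , v⊆ , d@(len , dv)) with ⊆-++[]⁻ (a ∷ u) v⊆
... | inj₁ v⊆u            = v , v⊆u , d
... | inj₂ ([] , refl , _) = [ a ] , refl ∷ minimum u , len , [] ∷ []
... | inj₂ (y ∷ v′ , refl , v′⊆u) with dv
...   | x<y ∷ _ = ⊥-elim (<-asym (All.head (All.++⁻ʳ v′ x<y)) (All.head (All-resp-⊆ v′⊆u u<x)))

oneTo : ℕ → List ℕ
oneTo n = map suc (upTo n)

oneTo-suc : ∀ n → oneTo (suc n) ≡ oneTo n ++ [ suc n ]
oneTo-suc n = trans (cong (map suc) (sym (upTo-∷ʳ n))) (map-++ suc (upTo n) [ n ])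

top∈oneTo : ∀ n → suc n ∈ oneTo (suc n)
top∈oneTo n = subst (suc n ∈_) (sym (oneTo-suc n)) (∈-++⁺ʳ (oneTo n) (here refl))

¬[]↭oneTo-suc : ∀ {n} → ¬ ([] ↭ oneTo (suc n))
¬[]↭oneTo-suc p = ¬x∷xs↭[] (↭-sym p)

module _ {n : ℕ} {w : List ℕ} (p : w ↭ oneTo n) where

  ↭-oneTo-bounded : All (_< suc n) w
  ↭-oneTo-bounded = All-resp-↭ (↭-sym p) (All.map⁺ (All.map s≤s (All.all-upTo n)))

  ↭-oneTo-unique : Unique w
  ↭-oneTo-unique = Unique-resp-↭ (↭⇒↭ₛ (↭-sym p)) (Unique.map⁺ suc-injective (Unique.upTo⁺ n))

  ↭-oneTo-max-last : w ++ [ suc n ] ↭ oneTo (suc n)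
  ↭-oneTo-max-last = subst (w ++ [ suc n ] ↭_) (sym (oneTo-suc n)) (↭.++⁺ʳ [ suc n ] p)

  ↭-oneTo-max-first : suc n ∷ w ↭ oneTo (suc n)
  ↭-oneTo-max-first = ↭-trans (∷↭∷ʳ (suc n) w) ↭-oneTo-max-last

↭-oneTo-top-pair-first : ∀ {n w} → w ↭ oneTo n → suc n ∷ suc (suc n) ∷ w ↭ oneTo (suc (suc n))
↭-oneTo-top-pair-first p = ↭-trans (swap _ _ ↭-refl) (↭-oneTo-max-first (↭-oneTo-max-first p))

↭-oneTo-remove-max : ∀ {n} α {β} → α ++ suc n ∷ β ↭ oneTo (suc n) → α ++ β ↭ oneTo n
↭-oneTo-remove-max {n} α {β} p =
  subst (α ++ β ↭_) (++-identityʳ (oneTo n))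
        (drop-mid α (oneTo n) (subst (α ++ suc n ∷ β ↭_) (oneTo-suc n) p))

Avoids-132-2341-3241 : List ℕ → Set
Avoids-132-2341-3241 w = ¬ Occurs Occ132 w × ¬ Occurs Occ2341 w × ¬ Occurs Occ3241 w

avoids-⊆ : ∀ {u w} → u ⊆ w → Avoids-132-2341-3241 w → Avoids-132-2341-3241 u
avoids-⊆ u⊆w (¬132 , ¬2341 , ¬3241) =
  ¬132 ∘ occurs-⊆ u⊆w , ¬2341 ∘ occurs-⊆ u⊆w , ¬3241 ∘ occurs-⊆ u⊆w

avoids-reflect : ∀ {u w} → (∀ {P} → MaxInsertionSafe P → Occurs P w → Occurs P u) →
                 Avoids-132-2341-3241 u → Avoids-132-2341-3241 w
avoids-reflect f (¬132 , ¬2341 , ¬3241) = ¬132 ∘ f safe-132 , ¬2341 ∘ f safe-2341 , ¬3241 ∘ f safe-3241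

avoids-[] : Avoids-132-2341-3241 []
avoids-[] = (λ { (_ , [] , ()) }) , (λ { (_ , [] , ()) }) , (λ { (_ , [] , ()) })

Restricted : ℕ → ℕ → List ℕ → Set
Restricted n k w = w ↭ oneTo n × Avoids-132-2341-3241 w × ¬ Occurs (Decreasing k) w

restricted⇔InP : ∀ {n k w} → Restricted n k w ⇔ InP n (applyDownFrom suc k) w
restricted⇔InP {k = k} = mk⇔
  (λ (p , (¬132 , ¬2341 , ¬3241) , ¬dec) →
     p , ¬132 ∘ to (contains⇔occurs orderIso-132) , ¬2341 ∘ to (contains⇔occurs orderIso-2341)
       , ¬3241 ∘ to (contains⇔occurs orderIso-3241)
       , ¬dec ∘ to (contains⇔occurs {applyDownFrom suc k} orderIso-decreasing))
  (λ (p , ¬132 , ¬2341 , ¬3241 , ¬dec) →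
     p , (¬132 ∘ from (contains⇔occurs orderIso-132) , ¬2341 ∘ from (contains⇔occurs orderIso-2341)
       , ¬3241 ∘ from (contains⇔occurs orderIso-3241))
       , ¬dec ∘ from (contains⇔occurs {applyDownFrom suc k} orderIso-decreasing))
  where open Equivalence

restricted-max-last : ∀ {n k α} → Restricted (suc n) (suc k) α → Restricted (2 + n) (suc k) (α ++ [ 2 + n ])
restricted-max-last {α = []}    (p , _) = ⊥-elim (¬[]↭oneTo-suc p)
restricted-max-last {α = _ ∷ _} (p , avoids , ¬dec) =
  ↭-oneTo-max-last p , avoids-reflect (λ safe → occurs-max-last safe bound) avoids
  , ¬dec ∘ occurs-decreasing-max-last bound
  where bound = ↭-oneTo-bounded p

restricted-max-first : ∀ {n k β} → Restricted n k β → Restricted (suc n) (suc k) (suc n ∷ β)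
restricted-max-first (p , avoids , ¬dec) =
  ↭-oneTo-max-first p , avoids-reflect (λ safe → occurs-max-first safe bound) avoids
  , ¬dec ∘ Equivalence.to (occurs-decreasing-max-first bound)
  where bound = ↭-oneTo-bounded p

restricted-top-pair-first : ∀ {n k β} → Restricted n k β → Restricted (2 + n) (suc k) (suc n ∷ 2 + n ∷ β)
restricted-top-pair-first (p , avoids , ¬dec) =
  ↭-oneTo-top-pair-first p , avoids-reflect (λ safe → occurs-top-pair-first safe bound) avoids
  , ¬dec ∘ Equivalence.to (occurs-decreasing-top-pair-first bound)
  where bound = ↭-oneTo-bounded p

restricted-empty : ∀ k w → w ≡ [] ⇔ Restricted 0 (suc k) w
restricted-empty k w = mk⇔ (λ { refl → ↭-refl , avoids-[] , λ { (_ , [] , () , _) } })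
                           (λ (p , _) → ↭-empty-inv p)

restricted-one : ∀ k w → Image (1 ∷_) (Restricted 0 k) w ⇔ Restricted 1 (suc k) w
restricted-one k w = mk⇔ (λ { (_ , r , refl) → restricted-max-first r }) from
  where
  from : Restricted 1 (suc k) w → Image (1 ∷_) (Restricted 0 k) w
  from (p , _ , ¬dec) with ↭-singleton-inv p
  ... | refl = [] , (↭-refl , avoids-[] , ¬dec ∘ Equivalence.from (occurs-decreasing-max-first [])) , refl

-- Where the maximum can sit

below-first : ∀ {N a β} → All (_< N) β → Unique (a ∷ β) → ¬ Occurs Occ132 (a ∷ N ∷ β) → All (_< a) β
below-first {N} {a} {β} β<N (a∉β ∷ _) ¬132 = All.tabulate below
  where
  below : ∀ {b} → b ∈ β → b < a
  below {b} b∈β with <-cmp a b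
  ... | tri< a<b _ _ =
    ⊥-elim (¬132 (a ∷ N ∷ b ∷ [] , refl ∷ refl ∷ from∈ b∈β , a<b , All.lookup β<N b∈β))
  ... | tri≈ _ a≡b _ = ⊥-elim (All.lookup a∉β b∈β a≡b)
  ... | tri> _ _ b<a = b<a

first-is-top : ∀ {n a β} → a ∷ β ↭ oneTo (suc n) → All (_< a) β → a ≡ suc n
first-is-top {n} p β<a with ∈-resp-↭ (↭-sym p) (top∈oneTo n)
... | here top≡a  = sym top≡a
... | there top∈β = ⊥-elim (<-irrefl refl (<-≤-trans (All.lookup β<a top∈β) a≤top))
  where a≤top = s≤s⁻¹ (All.head (↭-oneTo-bounded p))

¬two-before-max : ∀ {N a a′ b} → All (_< N) (a ∷ a′ ∷ b ∷ []) → Unique (a ∷ a′ ∷ b ∷ []) →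
                  ¬ Avoids-132-2341-3241 (a ∷ a′ ∷ N ∷ b ∷ [])
¬two-before-max {N} {a} {a′} {b} (a<N ∷ a′<N ∷ b<N ∷ [])
                ((a≢a′ ∷ a≢b ∷ []) ∷ (a′≢b ∷ []) ∷ _) (¬132 , ¬2341 , ¬3241)
  with <-cmp a b | <-cmp a′ b | <-cmp a a′
... | tri< a<b _ _ | _             | _             = ¬132 (_ , refl ∷ a′ ∷ʳ refl ∷ refl ∷ [] , a<b , b<N)
... | tri≈ _ a≡b _ | _             | _             = a≢b a≡b
... | tri> _ _ _   | tri< a′<b _ _ | _             = ¬132 (_ , a ∷ʳ refl ∷ refl ∷ refl ∷ [] , a′<b , b<N)
... | tri> _ _ _   | tri≈ _ a′≡b _ | _             = a′≢b a′≡b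
... | tri> _ _ b<a | tri> _ _ _    | tri< a<a′ _ _ = ¬2341 (_ , ⊆-refl , b<a , a<a′ , a′<N)
... | tri> _ _ _   | tri> _ _ _    | tri≈ _ a≡a′ _ = a≢a′ a≡a′
... | tri> _ _ _   | tri> _ _ b<a′ | tri> _ _ a′<a = ¬3241 (_ , ⊆-refl , b<a′ , a′<a , a<N)

-- For n = 0 the word 1 2 is already the case "maximum last".
TopPairFirst : ℕ → ℕ → List ℕ → Set
TopPairFirst zero    k = ∅
TopPairFirst (suc m) k = Image (λ β → 2 + m ∷ 3 + m ∷ β) (Restricted (suc m) k)

MaxPlacements : ℕ → ℕ → List ℕ → Set
MaxPlacements n k = Image (_++ [ 2 + n ]) (Restricted (suc n) (suc k))
                  ∪ (Image (2 + n ∷_) (Restricted (suc n) k) ∪ TopPairFirst n k)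

maxPlacements-sound : ∀ n k {w} → MaxPlacements n k w → Restricted (2 + n) (suc k) w
maxPlacements-sound n       k (inj₁ (_ , r , refl))        = restricted-max-last r
maxPlacements-sound n       k (inj₂ (inj₁ (_ , r , refl))) = restricted-max-first r
maxPlacements-sound (suc m) k (inj₂ (inj₂ (_ , r , refl))) = restricted-top-pair-first r

top-pair-case : ∀ {m k a β} → Restricted (3 + m) (suc k) (a ∷ 3 + m ∷ β) → a ∷ β ↭ oneTo (2 + m) →
                TopPairFirst (suc m) k (a ∷ 3 + m ∷ β)
top-pair-case (_ , avoids@(¬132 , _) , ¬dec) q
  with first-is-top q (below-first (All.tail (↭-oneTo-bounded q)) (↭-oneTo-unique q) ¬132)
... | refl = _ , (q′ , avoids-⊆ (_ ∷ʳ _ ∷ʳ ⊆-refl) avoids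
                 , ¬dec ∘ Equivalence.from (occurs-decreasing-top-pair-first (↭-oneTo-bounded q′))) , refl
  where q′ = ↭-oneTo-remove-max [] q

split-at-max : ∀ {n k} α β → Restricted (2 + n) (suc k) (α ++ 2 + n ∷ β) → α ++ β ↭ oneTo (suc n) →
               MaxPlacements n k (α ++ 2 + n ∷ β)
split-at-max {n} α [] (_ , avoids , ¬dec) q =
  inj₁ (α , (subst (_↭ oneTo (suc n)) (++-identityʳ α) q , avoids-⊆ α⊆ avoids , ¬dec ∘ occurs-⊆ α⊆)
         , refl)
  where α⊆ = ++⁺ʳ [ 2 + n ] (⊆-refl {x = α})
split-at-max {n} [] β (_ , avoids , ¬dec) q =
  inj₂ (inj₁ (β , (q , avoids-⊆ (2 + n ∷ʳ ⊆-refl) avoids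
                  , ¬dec ∘ Equivalence.from (occurs-decreasing-max-first (↭-oneTo-bounded q))) , refl))
split-at-max {zero}  (_ ∷ []) (_ ∷ _) _ q with ↭-length q
... | ()
split-at-max {suc m} (_ ∷ []) (_ ∷ _) r q = inj₂ (inj₂ (top-pair-case r q))
split-at-max (a ∷ a′ ∷ α) (b ∷ β) (_ , avoids , _) q =
  ⊥-elim (¬two-before-max (All-resp-⊆ sub (↭-oneTo-bounded q)) (AllPairs-resp-⊆ sub (↭-oneTo-unique q))
                          (avoids-⊆ (refl ∷ refl ∷ ++⁺ˡ α (refl ∷ refl ∷ minimum β)) avoids))
  where sub = refl ∷ refl ∷ ++⁺ˡ α (refl ∷ minimum β)

maxPlacements-complete : ∀ n k {w} → Restricted (2 + n) (suc k) w → MaxPlacements n k w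
maxPlacements-complete n k r@(p , _) with ∈-∃++ (∈-resp-↭ (↭-sym p) (top∈oneTo (suc n)))
... | α , β , refl = split-at-max α β r (↭-oneTo-remove-max α p)

last≢suffix-below : ∀ {x n} α γ {β} → β ↭ oneTo (suc n) → All (_< x) β → α ++ [ x ] ≢ γ ++ β
last≢suffix-below α γ {[]}    q _   _  = ¬[]↭oneTo-suc q
last≢suffix-below α γ {_ ∷ _} _ β<x eq = <-irrefl refl (All.lookup β<x (last-in-suffix α γ eq))

maxPlacements-disjointˡ : ∀ n k {w} → Image (_++ [ 2 + n ]) (Restricted (suc n) (suc k)) w →
                          ¬ (Image (2 + n ∷_) (Restricted (suc n) k) ∪ TopPairFirst n k) w
maxPlacements-disjointˡ n       k (α , _ , refl) (inj₁ (_ , (q , _) , eq)) =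
  last≢suffix-below α [ _ ] q (↭-oneTo-bounded q) (sym eq)
maxPlacements-disjointˡ (suc m) k (α , _ , refl) (inj₂ (_ , (q , _) , eq)) =
  last≢suffix-below α (_ ∷ _ ∷ []) q (All.map (λ y<x → <-trans y<x (n<1+n _)) (↭-oneTo-bounded q)) (sym eq)

maxPlacements-disjointʳ : ∀ n k {w} → Image (2 + n ∷_) (Restricted (suc n) k) w → ¬ TopPairFirst n k w
maxPlacements-disjointʳ (suc m) k (_ , _ , refl) (_ , _ , eq) = <-irrefl (∷-injectiveˡ eq) (n<1+n _)

count : ℕ → ℕ → ℕ
topPairCount : ℕ → ℕ → ℕ

count n             zero    = 0
count zero          (suc k) = 1
count (suc zero)    (suc k) = count zero k
count (suc (suc n)) (suc k) = count (suc n) (suc k) + (count (suc n) k + topPairCount n k)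

topPairCount zero    k = 0
topPairCount (suc m) k = count (suc m) k

restricted-hasCard : ∀ n k → HasCard (Restricted n k) (count n k)
topPairFirst-hasCard : ∀ n k → HasCard (TopPairFirst n k) (topPairCount n k)

restricted-hasCard n             zero    = hasCard-∅ λ w (_ , _ , ¬dec) → ¬dec ([] , minimum w , refl , [])
restricted-hasCard zero          (suc k) = hasCard-singleton [] (restricted-empty k)
restricted-hasCard (suc zero)    (suc k) =
  hasCard-resp (restricted-one k) (hasCard-image ∷-injectiveʳ (restricted-hasCard zero k))
restricted-hasCard (suc (suc n)) (suc k) =
  hasCard-resp (λ w → mk⇔ (maxPlacements-sound n k) (maxPlacements-complete n k))
    (hasCard-∪ (maxPlacements-disjointˡ n k)
      (hasCard-image (∷ʳ-injectiveˡ _ _) (restricted-hasCard (suc n) (suc k)))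
      (hasCard-∪ (maxPlacements-disjointʳ n k)
        (hasCard-image ∷-injectiveʳ (restricted-hasCard (suc n) k))
        (topPairFirst-hasCard n k)))

topPairFirst-hasCard zero    k = hasCard-∅ λ _ ()
topPairFirst-hasCard (suc m) k = hasCard-image (∷-injectiveʳ ∘ ∷-injectiveʳ) (restricted-hasCard (suc m) k)

inP-hasCard : ∀ n k → HasCard (InP n (applyDownFrom suc k)) (count n k)
inP-hasCard n k = hasCard-resp (λ _ → restricted⇔InP) (restricted-hasCard n k)

-- Closed forms

count-1 : ∀ n → count (suc n) 1 ≡ 0
count-1 zero          = refl
count-1 (suc zero)    = refl
count-1 (suc (suc n)) rewrite count-1 (suc n) = refl

count-2 : ∀ n → count (suc n) 2 ≡ 1
count-2 zero          = refl
count-2 (suc zero)    = refl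
count-2 (suc (suc n)) rewrite count-2 (suc n) | count-1 (suc n) | count-1 n = refl

count-3 : ∀ n → count (2 + n) 3 ≡ 2 + 2 * n
count-3 zero    = refl
count-3 (suc n) rewrite count-3 n | count-2 (suc n) | count-2 n = solve [ n ]

count-4 : ∀ n → count (3 + n) 4 ≡ 2 * n * n + 4 * n + 5
count-4 zero    = refl
count-4 (suc n) rewrite count-4 n | count-3 (suc n) | count-3 n = solve [ n ]

count-5 : ∀ n → 3 * count (4 + n) 5 ≡ 4 * n * n * n + 12 * n * n + 32 * n + 36
count-5 zero    = refl
count-5 (suc n) = begin
  3 * (a + (b + c))
    ≡⟨ distrib a b c ⟩
  3 * a + (3 * b + 3 * c)
    ≡⟨ cong₂ _+_ (count-5 n) (cong₂ _+_ (cong (3 *_) (count-4 (suc n))) (cong (3 *_) (count-4 n))) ⟩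
  4 * n * n * n + 12 * n * n + 32 * n + 36
    + (3 * (2 * suc n * suc n + 4 * suc n + 5) + 3 * (2 * n * n + 4 * n + 5))
    ≡⟨ solve [ n ] ⟩
  4 * suc n * suc n * suc n + 12 * suc n * suc n + 32 * suc n + 36 ∎
  where
  open ≡-Reasoning
  a = count (4 + n) 5
  b = count (4 + n) 4
  c = count (3 + n) 4
  distrib : ∀ x y z → 3 * (x + (y + z)) ≡ 3 * x + (3 * y + 3 * z)
  distrib = solve-∀

card-321 : (n : ℕ) → 2 ≤ n → HasCard (InP n (3 ∷ 2 ∷ 1 ∷ [])) (2 * n ∸ 2)
card-321 (suc (suc n)) (s≤s (s≤s _)) =
  subst (HasCard _) (trans (count-3 n) (sym (cong (_∸ 2) (*-distribˡ-+ 2 2 n)))) (inP-hasCard (2 + n) 3)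

card-4321 : (n : ℕ) → 3 ≤ n → Σ ℕ λ c → HasCard (InP n (4 ∷ 3 ∷ 2 ∷ 1 ∷ [])) c
            × (c + 8 * n ≡ 2 * n * n + 11)
card-4321 (suc (suc (suc n))) (s≤s (s≤s (s≤s _))) = count (3 + n) 4 , inP-hasCard (3 + n) 4 , closed-form
  where
  closed-form : count (3 + n) 4 + 8 * (3 + n) ≡ 2 * (3 + n) * (3 + n) + 11
  closed-form rewrite count-4 n = solve [ n ]

card-54321 : (n : ℕ) → 4 ≤ n → Σ ℕ λ c → HasCard (InP n (5 ∷ 4 ∷ 3 ∷ 2 ∷ 1 ∷ [])) c
             × (3 * c + 36 * n * n + 156 ≡ 4 * n * n * n + 128 * n)
card-54321 (suc (suc (suc (suc n)))) (s≤s (s≤s (s≤s (s≤s _)))) =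
  count (4 + n) 5 , inP-hasCard (4 + n) 5 , closed-form
  where
  closed-form : 3 * count (4 + n) 5 + 36 * (4 + n) * (4 + n) + 156
              ≡ 4 * (4 + n) * (4 + n) * (4 + n) + 128 * (4 + n)
  closed-form rewrite count-5 n = solve [ n ]

mainTheorem10 :
    ((n : ℕ) → 2 ≤ n → HasCard (InP n (3 ∷ 2 ∷ 1 ∷ [])) (2 * n ∸ 2))
    × ((n : ℕ) → 3 ≤ n → Σ ℕ λ c → HasCard (InP n (4 ∷ 3 ∷ 2 ∷ 1 ∷ [])) c
        × (c + 8 * n ≡ 2 * n * n + 11))
    × ((n : ℕ) → 4 ≤ n → Σ ℕ λ c → HasCard (InP n (5 ∷ 4 ∷ 3 ∷ 2 ∷ 1 ∷ [])) c
        × (3 * c + 36 * n * n + 156 ≡ 4 * n * n * n + 128 * n))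
mainTheorem10 = card-321 , card-4321 , card-54321
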